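{- Let $\mathcal{L}\in\{\mathrm{PL},\mathrm{PL}(\underline{\vee}),\mathrm{PD}\}$. The calculus $\mathbf{T}_{\mathcal{L}}$ is complete: every valid $\mathcal{L}$-formula $\varphi$ has a closed tableau for $\varphi$ in $\mathbf{T}_{\mathcal{L}}$.
   Context: Syntax (negation normal form): $\mathrm{PL}$: $\varphi::=p\mid\neg p\mid(\varphi\wedge\varphi)\mid(\varphi\vee\varphi)$; $\mathrm{PL}(\underline{\vee})$ adds $(\varphi\,\underline{\vee}\,\varphi)$; $\mathrm{PD}$ adds atoms ${=}(p_1,\dots,p_n,q)$. $p^\top:=p$, $p^\bot:=\neg p$. Team semantics: a team $X$ is a set of assignments $s:D\to\{0,1\}$ ($D$ a finite set of proposition symbols containing those of the formula). $X\models p$ iff $s(p)=1$ for all $s\in X$; $X\models\neg p$ iff $s(p)=0$ for all $s\in X$; $\wedge$ conjunctively; $X\models\varphi\vee\psi$ iff $X=Y\cup Z$ with $Y\models\varphi$, $Z\models\psi$; $X\models\varphi\,\underline{\vee}\,\psi$ iff $X\models\varphi$ or $X\models\psi$; $X\models{=}(p_1,\dots,p_n,q)$ iff any $s,t\in X$ agreeing on all $p_i$ agree on $q$. Valid: true in every team. $\mathrm{vrank}(\varphi)$: number of $\underline{\vee}$ in $\varphi$, where each ${=}(p_1,\dots,p_n,q)$ is counted via its replacement $\bigvee_{\vec a\in\{\bot,\top\}^n}\bigwedge\{p_1^{a_1},\dots,p_n^{a_n},(q\,\underline{\vee}\,\neg q)\}$. Labeled tableaux: labels are finite subsets of $\mathbb{N}$;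 labeled formulas $\alpha:\varphi$. A tableau is a finitely branching tree of labeled formulas built from the root by rule applications; each rule extends a branch containing its premise by alternatives (separated by $\mid$), each alternative adding all listed labeled formulas; a labeled formula is never added to a branch already containing it. Rules: (Prop) from $\{i_1,\dots,i_k\}:p$: $\{i_1\}:p\mid\dots\mid\{i_k\}:p$; ($\neg$Prop) likewise for $\neg p$; ($\wedge$) from $\alpha:(\varphi\wedge\psi)$: $\alpha:\varphi\mid\alpha:\psi$; ($\vee$) from $\alpha:(\varphi\vee\psi)$ and any $\beta\subseteq\alpha$: $\beta:\varphi\mid\alpha\setminus\beta:\psi$; ($\underline{\vee}$) from $\alpha:(\varphi\,\underline{\vee}\,\psi)$: add $\alpha:\varphi$ and $\alpha:\psi$; (Split) from $\alpha:{=}(\vec p,q)$: $\alpha_1:{=}(\vec p,q)\mid\dots\mid\alpha_k:{=}(\vec p,q)$ with $\alpha_1,\dots,\alpha_k$ all 2-element subsets of $\alpha$; (PL dep) from $\{i_1,i_2\}:{=}(p_1,\dots,p_n,q)$: one alternative per $g:\{1,\dots,n\}\to\{\top,\bot\}$ adding $\{i_1\}:p_m^{g(m)},\{i_2\}:p_m^{g(m)}$ ($m\le n$), $\{i_1,i_2\}:q$, $\{i_1,i_2\}:\neg q$. $\mathbf{T}_{\mathrm{PL}}$ = (Prop), ($\neg$Prop), ($\wedge$), ($\vee$); $\mathbf{T}_{\mathrm{PL}(\underline{\vee})}$ adds ($\underline{\vee}$); $\mathbf{T}_{\mathrm{PD}}$ adds (Split), (PL dep) to $\mathbf{T}_{\mathrm{PL}}$.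 A tableau for $\varphi$ in $\mathbf{T}_{\mathcal{L}}$ has root $\{1,\dots,2^{\mathrm{vrank}(\varphi)}\}:\varphi$ and uses rules of $\mathbf{T}_{\mathcal{L}}$. A branch is closed if it contains (1) both $\alpha:p$ and $\alpha:\neg p$, or (2) $\emptyset:\psi$ for some $\psi$, or (3) $\{i\}:{=}(p_1,\dots,p_n,q)$ for some $i$; a tableau is closed if all its branches are closed. -}

module Defs where

open import Data.Nat using (ℕ; zero; suc; _<_; _^_)
open import Data.Nat.Properties using (_<?_)
open import Data.Bool using (Bool; true; false; if_then_else_)
open import Data.Fin using (Fin; toℕ)
open import Data.Fin.Subset as S using (Subset; ⁅_⁆; _∪_; _─_; ∣_∣)
open import Data.List as List using (List; []; _∷_; _++_; concatMap; allFin; length; map)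
open import Data.List.Membership.Propositional using (_∈_)
open import Data.List.Relation.Binary.Subset.Propositional using (_⊆_)
open import Data.List.Relation.Unary.All using (All)
open import Data.Vec as Vec using (Vec)
open import Data.Product using (Σ; _×_; _,_)
open import Data.Sum using (_⊎_)
open import Data.Unit using (⊤)
open import Data.Empty renaming (⊥ to False)
open import Relation.Binary.PropositionalEquality using (_≡_; _≢_)
open import Relation.Nullary using (yes; no)

-- Syntax (negation normal form).  Proposition symbols are natural numbers.
-- One datatype holds all connectives; the three logics are carved out by
-- the predicate InL below.

data Form : Set where
  atom  : ℕ → Form
  natom : ℕ → Form
  _∧'_  : Form → Form → Form
  _∨'_  : Form → Form → Form
  _⊻'_  : Form → Form → Form
  dep   : List ℕ → ℕ → Form

data Logic : Set where
  PL PLv PD : Logic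

InL : Logic → Form → Set
InL L (atom p)  = ⊤
InL L (natom p) = ⊤
InL L (φ ∧' ψ)  = InL L φ × InL L ψ
InL L (φ ∨' ψ)  = InL L φ × InL L ψ
InL PL  (φ ⊻' ψ) = False
InL PLv (φ ⊻' ψ) = InL PLv φ × InL PLv ψ
InL PD  (φ ⊻' ψ) = False
InL PL  (dep ps q) = False
InL PLv (dep ps q) = False
InL PD  (dep ps q) = ⊤

lit : ℕ → Bool → Form
lit p true  = atom p
lit p false = natom p

-- Team semantics.  A team over the domain D = {0,…,n-1} is a finite set of
-- assignments s : D → {0,1}, represented by a list of vectors (a list
-- represents the set of its elements).

Assignment : ℕ → Set
Assignment n = Vec Bool n

Team : ℕ → Set
Team n = List (Assignment n)

-- value of proposition p under s (only used for p < n)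
val : ∀ {n} → Assignment n → ℕ → Bool
val Vec.[] p = false
val (b Vec.∷ s) zero    = b
val (b Vec.∷ s) (suc p) = val s p

infix 4 _⊨_
_⊨_ : ∀ {n} → Team n → Form → Set
X ⊨ atom p  = All (λ s → val s p ≡ true) X
X ⊨ natom p = All (λ s → val s p ≡ false) X
X ⊨ (φ ∧' ψ) = (X ⊨ φ) × (X ⊨ ψ)
X ⊨ (φ ∨' ψ) = Σ (List _) λ Y → Σ (List _) λ Z →
                 (X ⊆ Y ++ Z) × (Y ⊆ X) × (Z ⊆ X) × (Y ⊨ φ) × (Z ⊨ ψ)
X ⊨ (φ ⊻' ψ) = (X ⊨ φ) ⊎ (X ⊨ ψ)
X ⊨ dep ps q = ∀ s t → s ∈ X → t ∈ X →
                 All (λ p → val s p ≡ val t p) ps → val s q ≡ val t q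

AtomsBelow : ℕ → Form → Set
AtomsBelow n (atom p)   = p < n
AtomsBelow n (natom p)  = p < n
AtomsBelow n (φ ∧' ψ)   = AtomsBelow n φ × AtomsBelow n ψ
AtomsBelow n (φ ∨' ψ)   = AtomsBelow n φ × AtomsBelow n ψ
AtomsBelow n (φ ⊻' ψ)   = AtomsBelow n φ × AtomsBelow n ψ
AtomsBelow n (dep ps q) = All (λ p → p < n) ps × q < n

Valid : Form → Set
Valid φ = ∀ n → AtomsBelow n φ → (X : Team n) → X ⊨ φ

-- all g : {1,…,n} → {⊤,⊥}, as lists of length n
signs : ℕ → List (List Bool)
signs zero    = [] ∷ []
signs (suc n) = concatMap (λ g → (true ∷ g) ∷ (false ∷ g) ∷ []) (signs n)

bigOr : List Form → Form
bigOr []       = atom 0          -- never used (lists are nonempty)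
bigOr (φ ∷ []) = φ
bigOr (φ ∷ ψ ∷ φs) = φ ∨' bigOr (ψ ∷ φs)

bigAnd : List Form → Form
bigAnd []       = atom 0         -- never used (lists are nonempty)
bigAnd (φ ∷ []) = φ
bigAnd (φ ∷ ψ ∷ φs) = φ ∧' bigAnd (ψ ∷ φs)

lits : List ℕ → List Bool → List Form
lits (p ∷ ps) (b ∷ g) = lit p b ∷ lits ps g
lits _ _ = []

-- the PL(⊻)-replacement of =(p₁,…,pₙ,q)
depTrans : List ℕ → ℕ → Form
depTrans ps q = bigOr (map (λ g → bigAnd (lits ps g ++ ((atom q ⊻' natom q) ∷ []))) (signs (length ps)))

count⊻ : Form → ℕ
count⊻ (atom p)   = 0
count⊻ (natom p)  = 0
count⊻ (φ ∧' ψ)   = count⊻ φ Data.Nat.+ count⊻ ψ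
count⊻ (φ ∨' ψ)   = count⊻ φ Data.Nat.+ count⊻ ψ
count⊻ (φ ⊻' ψ)   = suc (count⊻ φ Data.Nat.+ count⊻ ψ)
count⊻ (dep ps q) = 0

vrank : Form → ℕ
vrank (atom p)   = 0
vrank (natom p)  = 0
vrank (φ ∧' ψ)   = vrank φ Data.Nat.+ vrank ψ
vrank (φ ∨' ψ)   = vrank φ Data.Nat.+ vrank ψ
vrank (φ ⊻' ψ)   = suc (vrank φ Data.Nat.+ vrank ψ)
vrank (dep ps q) = count⊻ (depTrans ps q)

-- In a tableau for φ all labels are subsets of the root
-- label {1,…,N}, N = 2^vrank φ; we represent {1,…,N} by Fin N, so a label is
-- a Subset N (canonical representation, so label equality is ≡).

record LForm (N : ℕ) : Set where
  constructor _∶_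
  field
    label : Subset N
    form  : Form

Branch : ℕ → Set
Branch N = List (LForm N)

elems : ∀ {N} → Subset N → List (Fin N)
elems {N} α = concatMap (λ i → if Vec.lookup α i then i ∷ [] else []) (allFin N)

pairs : ∀ {N} → Subset N → List (Subset N)
pairs α = concatMap (λ i → concatMap (λ j → f i j) (elems α)) (elems α)
  where
  f : ∀ {N} → Fin N → Fin N → List (Subset N)
  f i j with toℕ i <? toℕ j
  ... | yes _ = (⁅ i ⁆ ∪ ⁅ j ⁆) ∷ []
  ... | no  _ = []

-- Rule applications: Rule L B alts means that some rule of T_L, applied to a
-- premise on branch B, extends B by the alternatives alts (each alternative
-- being the list of labeled formulas it adds).
-- the alternative of (PL dep) for g
depAlt : ∀ {N} → Fin N → Fin N → List ℕ → ℕ → List Bool → Branch N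
depAlt i₁ i₂ ps q g =
  concatMap (λ φ → (⁅ i₁ ⁆ ∶ φ) ∷ (⁅ i₂ ⁆ ∶ φ) ∷ []) (lits ps g)
  ++ ((⁅ i₁ ⁆ ∪ ⁅ i₂ ⁆) ∶ atom q) ∷ ((⁅ i₁ ⁆ ∪ ⁅ i₂ ⁆) ∶ natom q) ∷ []

data Rule : Logic → ∀ {N} → Branch N → List (Branch N) → Set where
  rProp  : ∀ {L N} {B : Branch N} {α p} → (α ∶ atom p) ∈ B →
           Rule L B (map (λ i → (⁅ i ⁆ ∶ atom p) ∷ []) (elems α))
  rNProp : ∀ {L N} {B : Branch N} {α p} → (α ∶ natom p) ∈ B →
           Rule L B (map (λ i → (⁅ i ⁆ ∶ natom p) ∷ []) (elems α))
  r∧     : ∀ {L N} {B : Branch N} {α φ ψ} → (α ∶ (φ ∧' ψ)) ∈ B →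
           Rule L B (((α ∶ φ) ∷ []) ∷ ((α ∶ ψ) ∷ []) ∷ [])
  r∨     : ∀ {L N} {B : Branch N} {α φ ψ} → (α ∶ (φ ∨' ψ)) ∈ B →
           (β : Subset N) → β S.⊆ α →
           Rule L B (((β ∶ φ) ∷ []) ∷ (((α ─ β) ∶ ψ) ∷ []) ∷ [])
  r⊻     : ∀ {N} {B : Branch N} {α φ ψ} → (α ∶ (φ ⊻' ψ)) ∈ B →
           Rule PLv B (((α ∶ φ) ∷ (α ∶ ψ) ∷ []) ∷ [])
  rSplit : ∀ {N} {B : Branch N} {α ps q} → (α ∶ dep ps q) ∈ B →
           Rule PD B (map (λ β → (β ∶ dep ps q) ∷ []) (pairs α))
  rPLdep : ∀ {N} {B : Branch N} {ps q} (i₁ i₂ : Fin N) → i₁ ≢ i₂ →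
           ((⁅ i₁ ⁆ ∪ ⁅ i₂ ⁆) ∶ dep ps q) ∈ B →
           Rule PD B (map (λ g → depAlt i₁ i₂ ps q g) (signs (length ps)))

ClosedBranch : ∀ {N} → Branch N → Set
ClosedBranch {N} B =
    (Σ (Subset N) λ α → Σ ℕ λ p → ((α ∶ atom p) ∈ B) × ((α ∶ natom p) ∈ B))
  ⊎ (Σ Form λ ψ → (S.⊥ ∶ ψ) ∈ B)
  ⊎ (Σ (Fin N) λ i → Σ (List ℕ) λ ps → Σ ℕ λ q → (⁅ i ⁆ ∶ dep ps q) ∈ B)

-- Closable L B: the branch B can be extended, by rule applications of T_L,
-- into a finite tree all of whose branches are closed.  (A finite tableau
-- below a branch B, presented inductively: either B is closed, or a rule is
-- applied to a premise on B, with at least one alternative, and each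
-- extended branch is closable.)
data Closable (L : Logic) {N : ℕ} (B : Branch N) : Set where
  closed : ClosedBranch B → Closable L B
  step   : ∀ {alts} → Rule L B alts → alts ≢ [] →
           All (λ A → Closable L (B ++ A)) alts → Closable L B

ClosedTableau : Logic → Form → Set
ClosedTableau L φ = Closable L {2 ^ vrank φ} ((S.⊤ ∶ φ) ∷ [])

-- A labelled formula α ∶ ψ on a branch is read as the claim that the subteam indexed by α
-- falsifies ψ.  Expanding the root systematically (every split β ⊆ α of a ∨, every pair and
-- every sign pattern of a dependence atom), and carrying the obligations still pending on a
-- branch along as a continuation so that every alternative discharges them, either closes all
-- branches or reaches an open branch.  Its literals ⁅ i ⁆ ∶ p then define one assignment per
-- label index, and the resulting team falsifies every obligation on the branch, in particular
-- the root formula, contradicting validity.  Falsifying a ∨ only requires complementary splits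
-- α = β ∪ (α ─ β), which is enough because satisfaction is closed under subteams.

module Submission where

open import Defs
open import Data.Bool as Bool using (Bool; true; false; not; if_then_else_)
open import Data.Empty using (⊥; ⊥-elim)
open import Data.Fin using (Fin; zero; suc; toℕ)
open import Data.Fin.Properties using (toℕ-injective; suc-injective)
open import Data.Fin.Subset as S
  using (Subset; ⁅_⁆; _∪_; _∩_; _─_)
  renaming (_∈_ to _∈ₛ_; _∉_ to _∉ₛ_; _⊆_ to _⊆ₛ_)
open import Data.Fin.Subset.Properties
  using (nonempty?; Empty-unique; x∈⁅x⁆; x∈⁅y⁆⇒x≡y; x∈p∪q⁻; x∈p∩q⁺; x∈p∩q⁻; p∩q⊆p; p─q⊆p; _⊆?_)
open import Data.List as List using (List; []; _∷_; _++_; map; concatMap; allFin; length; filter)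
open import Data.List.Properties using (++-conicalˡ; ++-conicalʳ)
open import Data.List.Membership.Propositional using (_∈_; find; lose)
open import Data.List.Membership.Propositional.Properties
  using (∈-++⁺ˡ; ∈-++⁺ʳ; ∈-++⁻; ∈-map⁺; ∈-map⁻; ∈-concatMap⁺; ∈-concatMap⁻; ∈-allFin; ∈-filter⁺; ∈-filter⁻)
open import Data.List.Relation.Binary.Subset.Propositional using (_⊆_)
open import Data.List.Relation.Unary.All as All using (All; []; _∷_)
open import Data.List.Relation.Unary.All.Properties using (map⁺; anti-mono)
open import Data.List.Relation.Unary.Any as Any using (here; there; any?)
open import Data.Nat using (ℕ; zero; suc; _<_; _≤_; _⊔_; _^_; s≤s)
import Data.Nat.Properties as ℕ
open import Data.Nat.Properties using (_<?_; _≟_; <-irrefl; <-≤-trans; m≤m⊔n; m≤n⊔m; <-cmp)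
open import Data.Product using (∃-syntax; _×_; _,_; proj₁; proj₂)
open import Data.Sum using (_⊎_; inj₁; inj₂)
open import Data.Unit using (⊤; tt)
open import Data.Vec as Vec using (lookup; tabulate)
open import Data.Vec.Properties using (≡-dec; lookup∘tabulate; []=⇒lookup; lookup⇒[]=)
open import Function using (_∘_; id; case_of_)
open import Relation.Binary.Definitions using (tri<; tri≈; tri>)
open import Relation.Binary.PropositionalEquality using (_≡_; _≢_; refl; sym; trans; cong)
open import Relation.Nullary using (¬_; Dec; yes; no; does; contradiction)
open import Relation.Nullary.Decidable as Dec using (_×-dec_; dec-true; dec-false)
open import Relation.Unary using (Decidable)

private variable
  N : ℕ

map≢[] : ∀ {A B : Set} (f : A → B) {xs : List A} → xs ≢ [] → map f xs ≢ []
map≢[] f {[]}    xs≢[] _ = xs≢[] refl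
map≢[] f {_ ∷ _} _     ()

concatMap≡[] : ∀ {A B : Set} (g : A → List B) {x xs} → x ∈ xs → concatMap g xs ≡ [] → g x ≡ []
concatMap≡[] g {xs = y ∷ _} (here refl) e = ++-conicalˡ (g y) _ e
concatMap≡[] g {xs = y ∷ _} (there x∈) e = concatMap≡[] g x∈ (++-conicalʳ (g y) _ e)

∈⇒≢[] : ∀ {A : Set} {x : A} {xs} → x ∈ xs → xs ≢ []
∈⇒≢[] {xs = _ ∷ _} _ ()

x∈p─q⇒x∉q : ∀ (p q : Subset N) {x} → x ∈ₛ p ─ q → x ∉ₛ q
x∈p─q⇒x∉q (true  Vec.∷ p) (false Vec.∷ q) Vec.here          ()
x∈p─q⇒x∉q (_     Vec.∷ p) (_     Vec.∷ q) (Vec.there x∈p─q) (Vec.there x∈q) = x∈p─q⇒x∉q p q x∈p─q x∈q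

∈-elems⁺ : ∀ {α : Subset N} {i} → i ∈ₛ α → i ∈ elems α
∈-elems⁺ {α = α} {i} i∈α = ∈-concatMap⁺ _ (Any.map (λ { refl → selected }) (∈-allFin i))
  where
  selected : i ∈ (if lookup α i then i ∷ [] else [])
  selected rewrite []=⇒lookup i∈α = here refl

∈-elems⁻ : ∀ {α : Subset N} {i} → i ∈ elems α → i ∈ₛ α
∈-elems⁻ {N} {α} {i} i∈ with find (∈-concatMap⁻ _ {xs = allFin N} i∈)
... | k , _ , i∈selected with lookup α k in α[k] | i∈selected
...   | true | here refl = lookup⇒[]= k α α[k]

data Occupancy (α : Subset N) : Set where
  empty     : α ≡ S.⊥ → Occupancy α
  singleton : ∀ i → α ≡ ⁅ i ⁆ → Occupancy α
  twoOrMore : ∀ {i j} → i ≢ j → i ∈ₛ α → j ∈ₛ α → Occupancy α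

occupancy : ∀ (α : Subset N) → Occupancy α
occupancy Vec.[] = empty refl
occupancy (b Vec.∷ α) with b | occupancy α
... | false | empty α≡⊥         = empty (cong (false Vec.∷_) α≡⊥)
... | false | singleton i α≡⁅i⁆ = singleton (suc i) (cong (false Vec.∷_) α≡⁅i⁆)
... | true  | empty α≡⊥         = singleton zero (cong (true Vec.∷_) α≡⊥)
... | true  | singleton i refl  = twoOrMore {i = zero} (λ ()) Vec.here (Vec.there (x∈⁅x⁆ i))
... | _     | twoOrMore i≢j i∈α j∈α =
  twoOrMore (i≢j ∘ suc-injective) (Vec.there i∈α) (Vec.there j∈α)

subsetOf? : ∀ {P : Fin N → Set} → Decidable P → Subset N
subsetOf? P? = tabulate (does ∘ P?)

∈-subsetOf?⁺ : ∀ {P : Fin N → Set} (P? : Decidable P) {k} → P k → k ∈ₛ subsetOf? P?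
∈-subsetOf?⁺ P? {k} Pk = lookup⇒[]= k _ (trans (lookup∘tabulate _ k) (dec-true (P? k) Pk))

∈-subsetOf?⁻ : ∀ {P : Fin N → Set} (P? : Decidable P) {k} → k ∈ₛ subsetOf? P? → P k
∈-subsetOf?⁻ P? {k} k∈ with P? k | trans (sym (lookup∘tabulate (does ∘ P?) k)) ([]=⇒lookup k∈)
... | yes Pk | _ = Pk
... | no  _  | ()

∈-pairs⁻ : ∀ (α : Subset N) {β} → β ∈ pairs α →
  ∃[ i ] ∃[ j ] i ≢ j × i ∈ₛ α × j ∈ₛ α × β ≡ ⁅ i ⁆ ∪ ⁅ j ⁆
∈-pairs⁻ α β∈ with find (∈-concatMap⁻ _ {xs = elems α} β∈)
... | i , i∈ , β∈ᵢ with find (∈-concatMap⁻ _ {xs = elems α} β∈ᵢ)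
... | j , j∈ , β∈ᵢⱼ with toℕ i <? toℕ j | β∈ᵢⱼ
...   | yes i<j | here refl =
  i , j , (λ { refl → <-irrefl refl i<j }) , ∈-elems⁻ i∈ , ∈-elems⁻ j∈ , refl

pairs≢[]-< : ∀ (α : Subset N) {i j} → i ∈ₛ α → j ∈ₛ α → toℕ i < toℕ j → pairs α ≢ []
pairs≢[]-< α {i} {j} i∈α j∈α i<j pairs≡[]
  with concatMap≡[] _ (∈-elems⁺ j∈α) (concatMap≡[] _ (∈-elems⁺ i∈α) pairs≡[])
... | pairsᵢⱼ≡[] with toℕ i <? toℕ j
...   | yes _   = case pairsᵢⱼ≡[] of λ ()
...   | no  i≮j = i≮j i<j

pairs≢[] : ∀ (α : Subset N) {i j} → i ≢ j → i ∈ₛ α → j ∈ₛ α → pairs α ≢ []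
pairs≢[] α {i} {j} i≢j i∈α j∈α with <-cmp (toℕ i) (toℕ j)
... | tri< i<j _ _ = pairs≢[]-< α i∈α j∈α i<j
... | tri≈ _ i≡j _ = contradiction (toℕ-injective i≡j) i≢j
... | tri> _ _ j<i = pairs≢[]-< α j∈α i∈α j<i

constant-on-pair : ∀ {A : Set} (g : Fin N → A) {i j k} → g i ≡ g j → k ∈ₛ ⁅ i ⁆ ∪ ⁅ j ⁆ → g k ≡ g i
constant-on-pair g {i} {j} gi≡gj k∈ with x∈p∪q⁻ ⁅ i ⁆ ⁅ j ⁆ k∈
... | inj₁ k∈⁅i⁆ rewrite x∈⁅y⁆⇒x≡y i k∈⁅i⁆ = refl
... | inj₂ k∈⁅j⁆ rewrite x∈⁅y⁆⇒x≡y j k∈⁅j⁆ = sym gi≡gj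

allSubsets : ∀ n → List (Subset n)
allSubsets zero    = Vec.[] ∷ []
allSubsets (suc n) = map (true Vec.∷_) (allSubsets n) ++ map (false Vec.∷_) (allSubsets n)

∈-allSubsets : ∀ (β : Subset N) → β ∈ allSubsets N
∈-allSubsets Vec.[]          = here refl
∈-allSubsets (true  Vec.∷ β) = ∈-++⁺ˡ (∈-map⁺ _ (∈-allSubsets β))
∈-allSubsets (false Vec.∷ β) = ∈-++⁺ʳ _ (∈-map⁺ _ (∈-allSubsets β))

signs≢[] : ∀ n → signs n ≢ []
signs≢[] zero    ()
signs≢[] (suc n) with signs n | signs≢[] n
... | []    | signs≢[]ₙ = λ _ → signs≢[]ₙ refl
... | _ ∷ _ | _         = λ ()

∈-signs⇒length : ∀ n {g} → g ∈ signs n → length g ≡ n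
∈-signs⇒length zero    (here refl) = refl
∈-signs⇒length (suc n) g∈ with find (∈-concatMap⁻ _ {xs = signs n} g∈)
... | g′ , g′∈ , here refl         = cong suc (∈-signs⇒length n g′∈)
... | g′ , g′∈ , there (here refl) = cong suc (∈-signs⇒length n g′∈)

∈-depAlt-lits : ∀ {i₁ i₂ : Fin N} {ps q g φ} → φ ∈ lits ps g →
  ((⁅ i₁ ⁆ ∶ φ) ∈ depAlt i₁ i₂ ps q g) × ((⁅ i₂ ⁆ ∶ φ) ∈ depAlt i₁ i₂ ps q g)
∈-depAlt-lits φ∈ = ∈-++⁺ˡ (∈-concatMap⁺ _ (Any.map (λ { refl → here refl }) φ∈))
                 , ∈-++⁺ˡ (∈-concatMap⁺ _ (Any.map (λ { refl → there (here refl) }) φ∈))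

∈-depAlt-atom : ∀ {i₁ i₂ : Fin N} {ps q} g → ((⁅ i₁ ⁆ ∪ ⁅ i₂ ⁆) ∶ atom q) ∈ depAlt i₁ i₂ ps q g
∈-depAlt-atom g = ∈-++⁺ʳ _ (here refl)

∈-depAlt-natom : ∀ {i₁ i₂ : Fin N} {ps q} g → ((⁅ i₁ ⁆ ∪ ⁅ i₂ ⁆) ∶ natom q) ∈ depAlt i₁ i₂ ps q g
∈-depAlt-natom g = ∈-++⁺ʳ _ (there (here refl))

-- The systematic tableau

module Systematic (N : ℕ) where

  Valuation : Set
  Valuation = Fin N → ℕ → Bool

  Falsifies : Valuation → Subset N → Form → Set
  Falsifies f α (atom p)   = ∃[ i ] i ∈ₛ α × f i p ≡ false
  Falsifies f α (natom p)  = ∃[ i ] i ∈ₛ α × f i p ≡ true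
  Falsifies f α (φ ∧' ψ)   = Falsifies f α φ ⊎ Falsifies f α ψ
  Falsifies f α (φ ∨' ψ)   = ∀ β → β ⊆ₛ α → Falsifies f β φ ⊎ Falsifies f (α ─ β) ψ
  Falsifies f α (φ ⊻' ψ)   = Falsifies f α φ × Falsifies f α ψ
  Falsifies f α (dep ps q) = ∃[ i ] ∃[ j ] i ∈ₛ α × j ∈ₛ α × All (λ p → f i p ≡ f j p) ps × f i q ≢ f j q

  -- ⁅ i ⁆ ∶ p on a branch asks the i-th assignment to make p false.
  Respects : Valuation → Branch N → Set
  Respects f B = ∀ i p b → (⁅ i ⁆ ∶ lit p b) ∈ B → f i p ≡ not b

  Outcome : Logic → Branch N → (Valuation → Set) → Set
  Outcome L B P = Closable L B ⊎ ∃[ f ] Respects f B × P f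

  Continuation : Logic → Branch N → (Valuation → Set) → Set
  Continuation L B P = ∀ {B′} → B ⊆ B′ → Outcome L B′ P

  private variable
    L : Logic
    α : Subset N
    B B′ : Branch N
    P Q : Valuation → Set

  mapOutcome : (∀ {f} → Respects f B → P f → Q f) → Outcome L B P → Outcome L B Q
  mapOutcome g (inj₁ closable)          = inj₁ closable
  mapOutcome g (inj₂ (f , respects , p)) = inj₂ (f , respects , g respects p)

  restrictContinuation : B ⊆ B′ → Continuation L B P → Continuation L B′ P
  restrictContinuation B⊆B′ K B′⊆B″ = K (B′⊆B″ ∘ B⊆B′)

  allClosableOrRespected : ∀ {alts} → All (λ A → Outcome L (B ++ A) P) alts →
    All (λ A → Closable L (B ++ A)) alts ⊎ ∃[ f ] Respects f B × P f
  allClosableOrRespected [] = inj₁ []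
  allClosableOrRespected (inj₂ (f , respects , p) ∷ _) =
    inj₂ (f , (λ i q b → respects i q b ∘ ∈-++⁺ˡ) , p)
  allClosableOrRespected (inj₁ closable ∷ outcomes) with allClosableOrRespected outcomes
  ... | inj₁ closables    = inj₁ (closable ∷ closables)
  ... | inj₂ countermodel = inj₂ countermodel

  applyRule : ∀ {alts} → Rule L B alts → alts ≢ [] →
    All (λ A → Outcome L (B ++ A) P) alts → Outcome L B P
  applyRule rule alts≢[] outcomes with allClosableOrRespected outcomes
  ... | inj₁ closables    = inj₁ (step rule alts≢[] closables)
  ... | inj₂ countermodel = inj₂ countermodel

  closable-∅ : ∀ {ψ} → α ≡ S.⊥ → (α ∶ ψ) ∈ B → Closable L B
  closable-∅ {ψ = ψ} refl ∅∶ψ∈B = closed (inj₂ (inj₁ (ψ , ∅∶ψ∈B)))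

  literalRule : ∀ p b → (α ∶ lit p b) ∈ B → Rule L B (map (λ i → (⁅ i ⁆ ∶ lit p b) ∷ []) (elems α))
  literalRule p true  = rProp
  literalRule p false = rNProp

  refuteLiteral : ∀ p b → (α ∶ lit p b) ∈ B → Continuation L B P →
    Outcome L B (λ f → P f × ∃[ i ] i ∈ₛ α × f i p ≡ not b)
  refuteLiteral {α = α} {B = B} p b α∶l∈B K with nonempty? α
  ... | no  α-empty    = inj₁ (closable-∅ (Empty-unique α-empty) α∶l∈B)
  ... | yes (i , i∈α) =
    applyRule (literalRule p b α∶l∈B) (map≢[] _ (∈⇒≢[] (∈-elems⁺ i∈α)))
      (map⁺ (All.tabulate λ {k} k∈ →
        mapOutcome (λ respects x → x , k , ∈-elems⁻ k∈ , respects k p b (∈-++⁺ʳ B (here refl)))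
          (K ∈-++⁺ˡ)))

  agreeOnLits : ∀ {f i j} ps g → length g ≡ length ps → Respects f B →
    (∀ {φ} → φ ∈ lits ps g → ((⁅ i ⁆ ∶ φ) ∈ B) × ((⁅ j ⁆ ∶ φ) ∈ B)) → All (λ p → f i p ≡ f j p) ps
  agreeOnLits []       _       _   _        _ = []
  agreeOnLits (p ∷ ps) (b ∷ g) len respects both =
    trans (respects _ p b (proj₁ (both (here refl)))) (sym (respects _ p b (proj₂ (both (here refl)))))
    ∷ agreeOnLits ps g (ℕ.suc-injective len) respects (both ∘ there)

  refutePair : ∀ {ps q i₁ i₂} → i₁ ≢ i₂ → i₁ ∈ₛ α → i₂ ∈ₛ α →
    ((⁅ i₁ ⁆ ∪ ⁅ i₂ ⁆) ∶ dep ps q) ∈ B → Continuation PD B P →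
    Outcome PD B (λ f → P f × Falsifies f α (dep ps q))
  refutePair {α = α} {B = B} {P = P} {ps = ps} {q} {i₁} {i₂} i₁≢i₂ i₁∈α i₂∈α pair∈B K =
    applyRule (rPLdep i₁ i₂ i₁≢i₂ pair∈B) (map≢[] _ (signs≢[] (length ps)))
      (map⁺ (All.tabulate λ {g} g∈ → mapOutcome (conclude g∈)
        (refuteLiteral q true (∈-++⁺ʳ B (∈-depAlt-atom {ps = ps} g)) λ B⊆ →
          refuteLiteral q false (B⊆ (∈-++⁺ʳ B (∈-depAlt-natom {ps = ps} g)))
            (restrictContinuation (B⊆ ∘ ∈-++⁺ˡ) K))))
    where
    conclude : ∀ {g f} → g ∈ signs (length ps) → Respects f (B ++ depAlt i₁ i₂ ps q g) →
      (P f × ∃[ k′ ] k′ ∈ₛ ⁅ i₁ ⁆ ∪ ⁅ i₂ ⁆ × f k′ q ≡ true) ×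
      (∃[ k ] k ∈ₛ ⁅ i₁ ⁆ ∪ ⁅ i₂ ⁆ × f k q ≡ false) →
      P f × Falsifies f α (dep ps q)
    conclude {g} {f} g∈ respects ((p , k′ , k′∈ , fk′q≡true) , k , k∈ , fkq≡false) =
      p , i₁ , i₂ , i₁∈α , i₂∈α , agree , differ
      where
      agree : All (λ p → f i₁ p ≡ f i₂ p) ps
      agree = agreeOnLits ps g (∈-signs⇒length _ g∈) respects
        (λ φ∈ → ∈-++⁺ʳ B (proj₁ (∈-depAlt-lits φ∈)) , ∈-++⁺ʳ B (proj₂ (∈-depAlt-lits φ∈)))
      differ : f i₁ q ≢ f i₂ q
      differ fi₁q≡fi₂q with
        trans (sym fkq≡false) (trans (constant-on-pair (λ i → f i q) fi₁q≡fi₂q k∈)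
          (trans (sym (constant-on-pair (λ i → f i q) fi₁q≡fi₂q k′∈)) fk′q≡true))
      ... | ()

  refuteDependence : ∀ {ps q} → (α ∶ dep ps q) ∈ B → Continuation PD B P →
    Outcome PD B (λ f → P f × Falsifies f α (dep ps q))
  refuteDependence {α = α} {B = B} {P = P} {ps = ps} {q = q} h K with occupancy α
  ... | empty α≡⊥        = inj₁ (closable-∅ α≡⊥ h)
  ... | singleton i refl = inj₁ (closed (inj₂ (inj₂ (i , _ , _ , h))))
  ... | twoOrMore i≢j i∈α j∈α =
    applyRule (rSplit h) (map≢[] _ (pairs≢[] α i≢j i∈α j∈α)) (map⁺ (All.tabulate refuteSplit))
    where
    refuteSplit : ∀ {β} → β ∈ pairs α →
      Outcome PD (B ++ (β ∶ dep ps q) ∷ []) (λ f → P f × Falsifies f α (dep ps q))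
    refuteSplit β∈ with ∈-pairs⁻ α β∈
    ... | _ , _ , i₁≢i₂ , i₁∈α , i₂∈α , refl =
      refutePair i₁≢i₂ i₁∈α i₂∈α (∈-++⁺ʳ B (here refl)) (restrictContinuation ∈-++⁺ˡ K)

  SplitFalsifies : Valuation → Subset N → Form → Form → Subset N → Set
  SplitFalsifies f α φ ψ β = β ⊆ₛ α → Falsifies f β φ ⊎ Falsifies f (α ─ β) ψ

  mutual
    expand : ∀ L ψ → InL L ψ → (α ∶ ψ) ∈ B → Continuation L B P →
      Outcome L B (λ f → P f × Falsifies f α ψ)
    expand L (atom p)  _ h K = refuteLiteral p true  h K
    expand L (natom p) _ h K = refuteLiteral p false h K
    expand {α = α} {B = B} L (φ ∧' ψ) (φ∈L , ψ∈L) h K =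
      applyRule (r∧ h) (λ ())
        ( mapOutcome (λ _ (p , x) → p , inj₁ x)
            (expand L φ φ∈L (∈-++⁺ʳ B (here refl)) (restrictContinuation ∈-++⁺ˡ K))
        ∷ mapOutcome (λ _ (p , x) → p , inj₂ x)
            (expand L ψ ψ∈L (∈-++⁺ʳ B (here refl)) (restrictContinuation ∈-++⁺ˡ K))
        ∷ [])
    expand L (φ ∨' ψ) (φ∈L , ψ∈L) h K =
      mapOutcome (λ _ (p , splits) → p , λ β → All.lookup splits (∈-allSubsets β))
        (expand-∨ L φ∈L ψ∈L h (allSubsets N) K)
    expand {α = α} {B = B} PLv (φ ⊻' ψ) (φ∈L , ψ∈L) h K =
      applyRule (r⊻ h) (λ ())
        ( mapOutcome (λ _ ((p , xψ) , xφ) → p , xφ , xψ)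
            (expand PLv φ φ∈L (∈-++⁺ʳ B (here refl)) λ B⊆ →
              expand PLv ψ ψ∈L (B⊆ (∈-++⁺ʳ B (there (here refl))))
                (restrictContinuation (B⊆ ∘ ∈-++⁺ˡ) K))
        ∷ [])
    expand PD (dep ps q) _ h K = refuteDependence h K

    expand-∨ : ∀ L {φ ψ} → InL L φ → InL L ψ → (α ∶ (φ ∨' ψ)) ∈ B → (βs : List (Subset N)) →
      Continuation L B P → Outcome L B (λ f → P f × All (SplitFalsifies f α φ ψ) βs)
    expand-∨ L φ∈L ψ∈L h [] K = mapOutcome (λ _ p → p , []) (K id)
    expand-∨ {α = α} {B = B} {P = P} L {φ} {ψ} φ∈L ψ∈L h (β ∷ βs) K with β ⊆? α
    ... | no β⊈α =
      mapOutcome (λ _ (p , splits) → p , (λ β⊆α → contradiction β⊆α β⊈α) ∷ splits)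
        (expand-∨ L φ∈L ψ∈L h βs K)
    ... | yes β⊆α =
      applyRule (r∨ h β β⊆α) (λ ())
        ( mapOutcome (λ _ ((p , splits) , x) → p , (λ _ → inj₁ x) ∷ splits)
            (expand L φ φ∈L (∈-++⁺ʳ B (here refl)) (remaining (β ∶ φ)))
        ∷ mapOutcome (λ _ ((p , splits) , x) → p , (λ _ → inj₂ x) ∷ splits)
            (expand L ψ ψ∈L (∈-++⁺ʳ B (here refl)) (remaining ((α ─ β) ∶ ψ)))
        ∷ [])
      where
      remaining : ∀ e → Continuation L (B ++ e ∷ []) (λ f → P f × All (SplitFalsifies f α φ ψ) βs)
      remaining e B⊆ = expand-∨ L φ∈L ψ∈L (B⊆ (∈-++⁺ˡ h)) βs (restrictContinuation (B⊆ ∘ ∈-++⁺ˡ) K)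

  natom-≟ : ∀ α p (e : LForm N) → Dec ((α ∶ natom p) ≡ e)
  natom-≟ α p (β ∶ natom p′) =
    Dec.map′ (λ { (refl , refl) → refl }) (λ { refl → refl , refl }) (≡-dec Bool._≟_ α β ×-dec p ≟ p′)
  natom-≟ α p (β ∶ atom _)    = no λ ()
  natom-≟ α p (β ∶ (_ ∧' _))  = no λ ()
  natom-≟ α p (β ∶ (_ ∨' _))  = no λ ()
  natom-≟ α p (β ∶ (_ ⊻' _))  = no λ ()
  natom-≟ α p (β ∶ dep _ _)   = no λ ()

  ClashesIn : Branch N → LForm N → Set
  ClashesIn B (α ∶ atom p)   = (α ∶ natom p) ∈ B
  ClashesIn B (α ∶ natom _)  = ⊥
  ClashesIn B (α ∶ (_ ∧' _)) = ⊥
  ClashesIn B (α ∶ (_ ∨' _)) = ⊥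
  ClashesIn B (α ∶ (_ ⊻' _)) = ⊥
  ClashesIn B (α ∶ dep _ _)  = ⊥

  clashesIn? : ∀ B e → Dec (ClashesIn B e)
  clashesIn? B (α ∶ atom p)   = any? (natom-≟ α p) B
  clashesIn? B (α ∶ natom _)  = no λ ()
  clashesIn? B (α ∶ (_ ∧' _)) = no λ ()
  clashesIn? B (α ∶ (_ ∨' _)) = no λ ()
  clashesIn? B (α ∶ (_ ⊻' _)) = no λ ()
  clashesIn? B (α ∶ dep _ _)  = no λ ()

  clashOrRespected : ∀ L B → Outcome L B (λ _ → ⊤)
  clashOrRespected L B with any? (clashesIn? B) B
  ... | yes clash with find clash
  ...   | (α ∶ atom p) , α∶p∈B , α∶¬p∈B = inj₁ (closed (inj₁ (α , p , α∶p∈B , α∶¬p∈B)))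
  clashOrRespected L B | no noClash = inj₂ (f , respects , tt)
    where
    f : Valuation
    f i p = does (any? (natom-≟ ⁅ i ⁆ p) B)
    respects : Respects f B
    respects i p true  i∶p∈B  = dec-false (any? (natom-≟ ⁅ i ⁆ p) B) (noClash ∘ lose i∶p∈B)
    respects i p false i∶¬p∈B = dec-true (any? (natom-≟ ⁅ i ⁆ p) B) i∶¬p∈B

  closableOrFalsified : ∀ L ψ → InL L ψ → ∀ α → Closable L ((α ∶ ψ) ∷ []) ⊎ ∃[ f ] Falsifies f α ψ
  closableOrFalsified L ψ ψ∈L α with expand L ψ ψ∈L (here refl) (λ {B} _ → clashOrRespected L B)
  ... | inj₁ closable            = inj₁ closable
  ... | inj₂ (f , _ , _ , fals) = inj₂ (f , fals)

-- Teams

⊨-downward-closed : ∀ {n} ψ {X Y : Team n} → X ⊨ ψ → Y ⊆ X → Y ⊨ ψ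
⊨-downward-closed (atom p)   X⊨ Y⊆X = anti-mono Y⊆X X⊨
⊨-downward-closed (natom p)  X⊨ Y⊆X = anti-mono Y⊆X X⊨
⊨-downward-closed (φ ∧' ψ)   (X⊨φ , X⊨ψ) Y⊆X = ⊨-downward-closed φ X⊨φ Y⊆X , ⊨-downward-closed ψ X⊨ψ Y⊆X
⊨-downward-closed (φ ⊻' ψ)   (inj₁ X⊨φ) Y⊆X = inj₁ (⊨-downward-closed φ X⊨φ Y⊆X)
⊨-downward-closed (φ ⊻' ψ)   (inj₂ X⊨ψ) Y⊆X = inj₂ (⊨-downward-closed ψ X⊨ψ Y⊆X)
⊨-downward-closed (dep ps q) X⊨ Y⊆X = λ s t s∈ t∈ → X⊨ s t (Y⊆X s∈) (Y⊆X t∈)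
⊨-downward-closed {n} (φ ∨' ψ) {Y = Y} (X₁ , X₂ , X⊆X₁++X₂ , _ , _ , X₁⊨φ , X₂⊨ψ) Y⊆X =
  restrict X₁ , restrict X₂ , Y⊆ ,
  proj₂ ∘ ∈-filter⁻ (_∈? Y) {xs = X₁} , proj₂ ∘ ∈-filter⁻ (_∈? Y) {xs = X₂} ,
  ⊨-downward-closed φ X₁⊨φ (proj₁ ∘ ∈-filter⁻ (_∈? Y)) ,
  ⊨-downward-closed ψ X₂⊨ψ (proj₁ ∘ ∈-filter⁻ (_∈? Y))
  where
  open import Data.List.Membership.DecPropositional (≡-dec {n = n} Bool._≟_) using (_∈?_)
  restrict : Team n → Team n
  restrict = filter (_∈? Y)
  Y⊆ : Y ⊆ restrict X₁ ++ restrict X₂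
  Y⊆ s∈Y with ∈-++⁻ X₁ (X⊆X₁++X₂ (Y⊆X s∈Y))
  ... | inj₁ s∈X₁ = ∈-++⁺ˡ (∈-filter⁺ (_∈? Y) s∈X₁ s∈Y)
  ... | inj₂ s∈X₂ = ∈-++⁺ʳ (restrict X₁) (∈-filter⁺ (_∈? Y) s∈X₂ s∈Y)

assignment : ∀ n → (ℕ → Bool) → Assignment n
assignment zero    g = Vec.[]
assignment (suc n) g = g 0 Vec.∷ assignment n (g ∘ suc)

val-assignment : ∀ n (g : ℕ → Bool) {p} → p < n → val (assignment n g) p ≡ g p
val-assignment (suc n) g {zero}  _         = refl
val-assignment (suc n) g {suc p} (s≤s p<n) = val-assignment n (g ∘ suc) p<n

module _ (n : ℕ) {N} (f : Systematic.Valuation N) where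
  open Systematic N using (Falsifies)
  open import Data.List.Membership.DecPropositional (≡-dec {n = n} Bool._≟_) using (_∈?_)

  assignmentOf : Fin N → Assignment n
  assignmentOf k = assignment n (f k)

  teamOf : Subset N → Team n
  teamOf α = map assignmentOf (elems α)

  ∈-teamOf : ∀ {α k} → k ∈ₛ α → assignmentOf k ∈ teamOf α
  ∈-teamOf k∈α = ∈-map⁺ _ (∈-elems⁺ k∈α)

  teamOf-⊆ : ∀ α {Y} → (∀ {k} → k ∈ₛ α → assignmentOf k ∈ Y) → teamOf α ⊆ Y
  teamOf-⊆ α members s∈ with ∈-map⁻ _ s∈
  ... | k , k∈ , refl = members (∈-elems⁻ k∈)

  val-assignmentOf : ∀ {k p} → p < n → val (assignmentOf k) p ≡ f k p
  val-assignmentOf {k} = val-assignment n (f k)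

  landsIn? : ∀ Y → Decidable (λ k → assignmentOf k ∈ Y)
  landsIn? Y k = assignmentOf k ∈? Y

  -- The split of α that the tableau tried when the team of α is covered by Y ∪ Z.
  preimage : Subset N → Team n → Subset N
  preimage α Y = α ∩ subsetOf? (landsIn? Y)

  teamOf-preimage : ∀ α Y → teamOf (preimage α Y) ⊆ Y
  teamOf-preimage α Y = teamOf-⊆ (preimage α Y) (∈-subsetOf?⁻ (landsIn? Y) ∘ proj₂ ∘ x∈p∩q⁻ α _)

  teamOf-─preimage : ∀ α Y Z → teamOf α ⊆ Y ++ Z → teamOf (α ─ preimage α Y) ⊆ Z
  teamOf-─preimage α Y Z α⊆Y++Z =
    teamOf-⊆ _ λ k∈ → inZ k∈ (∈-++⁻ Y (α⊆Y++Z (∈-teamOf (p─q⊆p α _ k∈))))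
    where
    inZ : ∀ {k} → k ∈ₛ α ─ preimage α Y → assignmentOf k ∈ Y ⊎ assignmentOf k ∈ Z → assignmentOf k ∈ Z
    inZ k∈ (inj₁ k↦Y) =
      contradiction (x∈p∩q⁺ (p─q⊆p α _ k∈ , ∈-subsetOf?⁺ (landsIn? Y) k↦Y)) (x∈p─q⇒x∉q α _ k∈)
    inZ k∈ (inj₂ k↦Z) = k↦Z

  falsifies⇒⊭ : ∀ ψ α → AtomsBelow n ψ → Falsifies f α ψ → ¬ (teamOf α ⊨ ψ)
  falsifies⇒⊭ (atom p) α p<n (i , i∈α , fip≡false) α⊨p =
    case trans (sym fip≡false) (trans (sym (val-assignmentOf p<n)) (All.lookup α⊨p (∈-teamOf i∈α))) of λ ()
  falsifies⇒⊭ (natom p) α p<n (i , i∈α , fip≡true) α⊨¬p =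
    case trans (sym fip≡true) (trans (sym (val-assignmentOf p<n)) (All.lookup α⊨¬p (∈-teamOf i∈α))) of λ ()
  falsifies⇒⊭ (φ ∧' ψ) α (φ< , _) (inj₁ xφ) (α⊨φ , _) = falsifies⇒⊭ φ α φ< xφ α⊨φ
  falsifies⇒⊭ (φ ∧' ψ) α (_ , ψ<) (inj₂ xψ) (_ , α⊨ψ) = falsifies⇒⊭ ψ α ψ< xψ α⊨ψ
  falsifies⇒⊭ (φ ⊻' ψ) α (φ< , _) (xφ , _) (inj₁ α⊨φ) = falsifies⇒⊭ φ α φ< xφ α⊨φ
  falsifies⇒⊭ (φ ⊻' ψ) α (_ , ψ<) (_ , xψ) (inj₂ α⊨ψ) = falsifies⇒⊭ ψ α ψ< xψ α⊨ψ
  falsifies⇒⊭ (dep ps q) α (ps< , q<n) (i , j , i∈α , j∈α , agree , differ) α⊨dep =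
    differ (trans (sym (val-assignmentOf q<n))
             (trans (α⊨dep _ _ (∈-teamOf i∈α) (∈-teamOf j∈α) agreeᵥ) (val-assignmentOf q<n)))
    where
    agreeᵥ : All (λ p → val (assignmentOf i) p ≡ val (assignmentOf j) p) ps
    agreeᵥ = All.zipWith (λ (p<n , e) → trans (val-assignmentOf p<n) (trans e (sym (val-assignmentOf p<n))))
                         (ps< , agree)
  falsifies⇒⊭ (φ ∨' ψ) α (φ< , ψ<) split (Y , Z , α⊆Y++Z , _ , _ , Y⊨φ , Z⊨ψ)
    with split (preimage α Y) (p∩q⊆p α _)
  ... | inj₁ xφ = falsifies⇒⊭ φ _ φ< xφ (⊨-downward-closed φ Y⊨φ (teamOf-preimage α Y))
  ... | inj₂ xψ = falsifies⇒⊭ ψ _ ψ< xψ (⊨-downward-closed ψ Z⊨ψ (teamOf-─preimage α Y Z α⊆Y++Z))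

atomsBelow-mono : ∀ ψ {m n} → m ≤ n → AtomsBelow m ψ → AtomsBelow n ψ
atomsBelow-mono (atom p)   m≤n p<m         = <-≤-trans p<m m≤n
atomsBelow-mono (natom p)  m≤n p<m         = <-≤-trans p<m m≤n
atomsBelow-mono (φ ∧' ψ)   m≤n (φ< , ψ<)   = atomsBelow-mono φ m≤n φ< , atomsBelow-mono ψ m≤n ψ<
atomsBelow-mono (φ ∨' ψ)   m≤n (φ< , ψ<)   = atomsBelow-mono φ m≤n φ< , atomsBelow-mono ψ m≤n ψ<
atomsBelow-mono (φ ⊻' ψ)   m≤n (φ< , ψ<)   = atomsBelow-mono φ m≤n φ< , atomsBelow-mono ψ m≤n ψ<
atomsBelow-mono (dep ps q) m≤n (ps< , q<m) = All.map (λ p<m → <-≤-trans p<m m≤n) ps< , <-≤-trans q<m m≤n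

atomsBelow-both : ∀ φ ψ → ∃[ m ] AtomsBelow m φ → ∃[ n ] AtomsBelow n ψ →
  ∃[ k ] AtomsBelow k φ × AtomsBelow k ψ
atomsBelow-both φ ψ (m , φ<) (n , ψ<) =
  m ⊔ n , atomsBelow-mono φ (m≤m⊔n m n) φ< , atomsBelow-mono ψ (m≤n⊔m m n) ψ<

allBelow : ∀ (ps : List ℕ) → ∃[ n ] All (_< n) ps
allBelow []       = 0 , []
allBelow (p ∷ ps) with allBelow ps
... | n , ps<n = suc p ⊔ n , m≤m⊔n (suc p) n ∷ All.map (λ q<n → <-≤-trans q<n (m≤n⊔m (suc p) n)) ps<n

atomsBelow-exists : ∀ ψ → ∃[ n ] AtomsBelow n ψ
atomsBelow-exists (atom p)   = suc p , ℕ.≤-refl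
atomsBelow-exists (natom p)  = suc p , ℕ.≤-refl
atomsBelow-exists (φ ∧' ψ)   = atomsBelow-both φ ψ (atomsBelow-exists φ) (atomsBelow-exists ψ)
atomsBelow-exists (φ ∨' ψ)   = atomsBelow-both φ ψ (atomsBelow-exists φ) (atomsBelow-exists ψ)
atomsBelow-exists (φ ⊻' ψ)   = atomsBelow-both φ ψ (atomsBelow-exists φ) (atomsBelow-exists ψ)
atomsBelow-exists (dep ps q) with allBelow (q ∷ ps)
... | n , q<n ∷ ps<n = n , ps<n , q<n

theorem5 : (L : Logic) (φ : Form) → InL L φ → Valid φ → ClosedTableau L φ
theorem5 L φ φ∈L valid with Systematic.closableOrFalsified (2 ^ vrank φ) L φ φ∈L S.⊤
... | inj₁ closable     = closable
... | inj₂ (f , fals) with atomsBelow-exists φ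
...   | n , φ<n = ⊥-elim (falsifies⇒⊭ n f φ S.⊤ φ<n fals (valid n φ<n (teamOf n f S.⊤)))
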